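{- Let $\mathbf{C}$ be the natural deduction system described in the context. If $\Pi$ is a deduction in $\mathbf{C}$ in normal form, then every major premise of an application of an elimination rule in $\Pi$ is a (discharged or undischarged) assumption of $\Pi$.
   Context: Formulas are built from atomic formulas (formulas containing no connective) by the connectives $\neg$ (unary), $\supset$, $\land$, $\lor$. Deductions in $\mathbf{C}$ are trees of formula occurrences whose leaves are assumptions; each assumption belongs to an assumption class marked by a number, and a rule discharging class $i$ (written $[X]^i$) discharges all assumptions of that class above the indicated premise. A single assumption $A$ is a deduction of $A$ from $A$. Rules ($C$ arbitrary): $\land I$: from $A$, $B$, and a deduction of $C$ from $[A\land B]$, infer $C$. $\land E$: from $A\land B$ and a deduction of $C$ from $[A]$, $[B]$, infer $C$. $\lor I$: from $A$ (or from $B$) and a deduction of $C$ from $[A\lor B]$, infer $C$. $\lor E$: from $A\lor B$, a deduction of $C$ from $[A]$, and a deduction of $C$ from $[B]$, infer $C$. $\supset I$: from $B$ and a deduction of $C$ from $[A\supset B]$, infer $C$. $TR$ (an introduction rule for $\supset$): from a deduction of $C$ from $[A]$ and a deduction of $C$ from $[A\supset B]$, infer $C$. $\supset E$: from $A\supset B$, $A$, and a deduction of $C$ from $[B]$, infer $C$. $\neg I$: from a deduction of $C$ from $[A]$ and a deduction of $C$ from $[\neg A]$, infer $C$. $\neg E$: from $\neg A$ and $A$, infer $C$. Introduction rules: $\land I,\lor I,\supset I,TR,\neg I$; elimination rules: $\land E,\lor E,\supset E,\neg E$. In elimination rules $A\land B, A\lor B, A\supset B,\neg A$ are the major premises; premises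 in the place of $C$ (in any rule) are arbitrary premises; the discharged $A\land B$, $A\lor B$, $A\supset B$ (in $\supset I$ and $TR$), $\neg A$ (in $\neg I$) are the major assumptions discharged by the introduction rule. Convention: there is no vacuous discharge above arbitrary premises. A maximal formula is an occurrence of a formula with main connective $\ast$ that is both the major premise of an application of $\ast E$ and the major assumption discharged by an application of $\ast I$ (or of $TR$ when $\ast$ is $\supset$). A segment is a sequence $C_1,\dots,C_n$ of occurrences of the same formula such that for all $i<n$, $C_i$ is an arbitrary premise of a rule application whose conclusion is $C_{i+1}$, $C_n$ is not an arbitrary premise of any rule application, and either $n>1$, or $n\ge 1$ and $C_1$ is the conclusion of an application of $\neg E$. A maximal segment is a segment whose last formula is the major premise of an elimination rule. A deduction is in normal form if it contains neither maximal formulas nor maximal segments. -}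

module Defs where

open import Data.Nat using (ℕ)
open import Data.List using (List; []; _∷_; _++_)
open import Data.Maybe using (Maybe; just; nothing)
open import Data.Product using (Σ; _×_; _,_; ∃)
open import Data.Sum using (_⊎_)
open import Relation.Binary.PropositionalEquality using (_≡_; _≢_)
open import Relation.Nullary using (¬_)

data Formula : Set where
  atom : ℕ → Formula
  neg  : Formula → Formula
  _⊃_  : Formula → Formula → Formula
  _∧_  : Formula → Formula → Formula
  _∨_  : Formula → Formula → Formula

infixr 5 _⊃_
infixr 6 _∨_
infixr 7 _∧_

data Conn : Set where
  c∧ c∨ c⊃ c¬ : Conn

-- Natural numbers of type ℕ in rule nodes are the assumption-class labels
-- discharged by that rule application.  Children are numbered 0,1,2,...
-- in the order the premises are listed in the rule descriptions.

data Tree : Set where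
  hyp : (i : ℕ) (A : Formula) → Tree                   -- assumption A of class i
  -- ∧I : premises A , B , C [A∧B]^i
  ∧I  : (i : ℕ) (a b c : Tree) → Tree
  -- ∧E : premises A∧B , C [A]^i [B]^j
  ∧E  : (i j : ℕ) (m c : Tree) → Tree
  -- ∨I : premises A , C [A∨B]^i   (resp. B , C [A∨B]^i)
  ∨I₁ : (B : Formula) (i : ℕ) (a c : Tree) → Tree
  ∨I₂ : (A : Formula) (i : ℕ) (b c : Tree) → Tree
  -- ∨E : premises A∨B , C [A]^i , C [B]^j
  ∨E  : (i j : ℕ) (m c₁ c₂ : Tree) → Tree
  -- ⊃I : premises B , C [A⊃B]^i
  ⊃I  : (A : Formula) (i : ℕ) (b c : Tree) → Tree
  -- TR : premises C [A]^i , C [A⊃B]^j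
  TR  : (A B : Formula) (i j : ℕ) (c₁ c₂ : Tree) → Tree
  -- ⊃E : premises A⊃B , A , C [B]^i
  ⊃E  : (i : ℕ) (m a c : Tree) → Tree
  -- ¬I : premises C [A]^i , C [¬A]^j
  ¬I  : (A : Formula) (i j : ℕ) (c₁ c₂ : Tree) → Tree
  -- ¬E : premises ¬A , A ; conclusion C
  ¬E  : (C : Formula) (m a : Tree) → Tree

concl : Tree → Formula
concl (hyp i A)          = A
concl (∧I i a b c)       = concl c
concl (∧E i j m c)       = concl c
concl (∨I₁ B i a c)      = concl c
concl (∨I₂ A i b c)      = concl c
concl (∨E i j m c₁ c₂)   = concl c₁
concl (⊃I A i b c)       = concl c
concl (TR A B i j c₁ c₂) = concl c₁
concl (⊃E i m a c)       = concl c
concl (¬I A i j c₁ c₂)   = concl c₁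
concl (¬E C m a)         = C

child : Tree → ℕ → Maybe Tree
child (∧I i a b c)       0 = just a
child (∧I i a b c)       1 = just b
child (∧I i a b c)       2 = just c
child (∧E i j m c)       0 = just m
child (∧E i j m c)       1 = just c
child (∨I₁ B i a c)      0 = just a
child (∨I₁ B i a c)      1 = just c
child (∨I₂ A i b c)      0 = just b
child (∨I₂ A i b c)      1 = just c
child (∨E i j m c₁ c₂)   0 = just m
child (∨E i j m c₁ c₂)   1 = just c₁
child (∨E i j m c₁ c₂)   2 = just c₂
child (⊃I A i b c)       0 = just b
child (⊃I A i b c)       1 = just c
child (TR A B i j c₁ c₂) 0 = just c₁
child (TR A B i j c₁ c₂) 1 = just c₂
child (⊃E i m a c)       0 = just m
child (⊃E i m a c)       1 = just a
child (⊃E i m a c)       2 = just c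
child (¬I A i j c₁ c₂)   0 = just c₁
child (¬I A i j c₁ c₂)   1 = just c₂
child (¬E C m a)         0 = just m
child (¬E C m a)         1 = just a
child _                  _ = nothing

-- Positions of formula occurrences: paths of child indices from the root.
Pos : Set
Pos = List ℕ

at : Tree → Pos → Maybe Tree
at t []      = just t
at t (k ∷ p) with child t k
... | just c  = at c p
... | nothing = nothing

-- DischLabel t k i : the rule application at the root of t discharges
-- assumption class i above its k-th premise.
data DischLabel : Tree → ℕ → ℕ → Set where
  d∧I  : ∀ {i a b c} → DischLabel (∧I i a b c) 2 i
  d∧E₁ : ∀ {i j m c} → DischLabel (∧E i j m c) 1 i
  d∧E₂ : ∀ {i j m c} → DischLabel (∧E i j m c) 1 j
  d∨I₁ : ∀ {B i a c} → DischLabel (∨I₁ B i a c) 1 i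
  d∨I₂ : ∀ {A i b c} → DischLabel (∨I₂ A i b c) 1 i
  d∨E₁ : ∀ {i j m c₁ c₂} → DischLabel (∨E i j m c₁ c₂) 1 i
  d∨E₂ : ∀ {i j m c₁ c₂} → DischLabel (∨E i j m c₁ c₂) 2 j
  d⊃I  : ∀ {A i b c} → DischLabel (⊃I A i b c) 1 i
  dTR₁ : ∀ {A B i j c₁ c₂} → DischLabel (TR A B i j c₁ c₂) 0 i
  dTR₂ : ∀ {A B i j c₁ c₂} → DischLabel (TR A B i j c₁ c₂) 1 j
  d⊃E  : ∀ {i m a c} → DischLabel (⊃E i m a c) 2 i
  d¬I₁ : ∀ {A i j c₁ c₂} → DischLabel (¬I A i j c₁ c₂) 0 i
  d¬I₂ : ∀ {A i j c₁ c₂} → DischLabel (¬I A i j c₁ c₂) 1 j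

-- OpenAt t p i A : the occurrence at position p of t is an assumption A of
-- class i which is not discharged inside t (open in t).
data OpenAt : Tree → Pos → ℕ → Formula → Set where
  here  : ∀ {i A} → OpenAt (hyp i A) [] i A
  there : ∀ {t k c p i A} → child t k ≡ just c → OpenAt c p i A →
          ¬ DischLabel t k i → OpenAt t (k ∷ p) i A

-- A rule discharging class i with formula X above premise c:
-- every open assumption of class i in c is X (classes consist of
-- occurrences of one formula), and the discharge is not vacuous
-- (convention: no vacuous discharge above arbitrary premises; in C every
-- discharge happens above an arbitrary premise).
Discharge : Tree → ℕ → Formula → Set
Discharge c i X = (∃ λ p → OpenAt c p i X) × (∀ p Y → OpenAt c p i Y → Y ≡ X)

data Deduction : Tree → Set where
  hyp : ∀ {i A} → Deduction (hyp i A)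
  ∧I  : ∀ {i a b c} → Deduction a → Deduction b → Deduction c →
        Discharge c i (concl a ∧ concl b) → Deduction (∧I i a b c)
  ∧E  : ∀ {i j m c A B} → Deduction m → Deduction c → concl m ≡ A ∧ B →
        Discharge c i A → Discharge c j B → Deduction (∧E i j m c)
  ∨I₁ : ∀ {B i a c} → Deduction a → Deduction c →
        Discharge c i (concl a ∨ B) → Deduction (∨I₁ B i a c)
  ∨I₂ : ∀ {A i b c} → Deduction b → Deduction c →
        Discharge c i (A ∨ concl b) → Deduction (∨I₂ A i b c)
  ∨E  : ∀ {i j m c₁ c₂ A B} → Deduction m → Deduction c₁ → Deduction c₂ →
        concl m ≡ A ∨ B → concl c₁ ≡ concl c₂ →
        Discharge c₁ i A → Discharge c₂ j B → Deduction (∨E i j m c₁ c₂)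
  ⊃I  : ∀ {A i b c} → Deduction b → Deduction c →
        Discharge c i (A ⊃ concl b) → Deduction (⊃I A i b c)
  TR  : ∀ {A B i j c₁ c₂} → Deduction c₁ → Deduction c₂ → concl c₁ ≡ concl c₂ →
        Discharge c₁ i A → Discharge c₂ j (A ⊃ B) → Deduction (TR A B i j c₁ c₂)
  ⊃E  : ∀ {i m a c B} → Deduction m → Deduction a → Deduction c →
        concl m ≡ concl a ⊃ B → Discharge c i B → Deduction (⊃E i m a c)
  ¬I  : ∀ {A i j c₁ c₂} → Deduction c₁ → Deduction c₂ → concl c₁ ≡ concl c₂ →
        Discharge c₁ i A → Discharge c₂ j (neg A) → Deduction (¬I A i j c₁ c₂)
  ¬E  : ∀ {C m a} → Deduction m → Deduction a → concl m ≡ neg (concl a) →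
        Deduction (¬E C m a)

-- Arbitrary t k : the k-th premise of the rule application at the root of t
-- is an arbitrary premise (a premise in the place of C).
data Arbitrary : Tree → ℕ → Set where
  a∧I  : ∀ {i a b c} → Arbitrary (∧I i a b c) 2
  a∧E  : ∀ {i j m c} → Arbitrary (∧E i j m c) 1
  a∨I₁ : ∀ {B i a c} → Arbitrary (∨I₁ B i a c) 1
  a∨I₂ : ∀ {A i b c} → Arbitrary (∨I₂ A i b c) 1
  a∨E₁ : ∀ {i j m c₁ c₂} → Arbitrary (∨E i j m c₁ c₂) 1
  a∨E₂ : ∀ {i j m c₁ c₂} → Arbitrary (∨E i j m c₁ c₂) 2
  a⊃I  : ∀ {A i b c} → Arbitrary (⊃I A i b c) 1
  aTR₁ : ∀ {A B i j c₁ c₂} → Arbitrary (TR A B i j c₁ c₂) 0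
  aTR₂ : ∀ {A B i j c₁ c₂} → Arbitrary (TR A B i j c₁ c₂) 1
  a⊃E  : ∀ {i m a c} → Arbitrary (⊃E i m a c) 2
  a¬I₁ : ∀ {A i j c₁ c₂} → Arbitrary (¬I A i j c₁ c₂) 0
  a¬I₂ : ∀ {A i j c₁ c₂} → Arbitrary (¬I A i j c₁ c₂) 1

-- Elim ∗ t k : the root of t is an application of ∗E whose major premise
-- is its k-th premise.
data Elim : Conn → Tree → ℕ → Set where
  e∧ : ∀ {i j m c} → Elim c∧ (∧E i j m c) 0
  e∨ : ∀ {i j m c₁ c₂} → Elim c∨ (∨E i j m c₁ c₂) 0
  e⊃ : ∀ {i m a c} → Elim c⊃ (⊃E i m a c) 0
  e¬ : ∀ {C m a} → Elim c¬ (¬E C m a) 0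

-- IntroMajor ∗ t k i : the root of t is an application of ∗I (or TR, for ⊃)
-- which discharges its major assumption, of class i, above its k-th premise.
data IntroMajor : Conn → Tree → ℕ → ℕ → Set where
  i∧  : ∀ {i a b c} → IntroMajor c∧ (∧I i a b c) 2 i
  i∨₁ : ∀ {B i a c} → IntroMajor c∨ (∨I₁ B i a c) 1 i
  i∨₂ : ∀ {A i b c} → IntroMajor c∨ (∨I₂ A i b c) 1 i
  i⊃  : ∀ {A i b c} → IntroMajor c⊃ (⊃I A i b c) 1 i
  iTR : ∀ {A B i j c₁ c₂} → IntroMajor c⊃ (TR A B i j c₁ c₂) 1 j
  i¬  : ∀ {A i j c₁ c₂} → IntroMajor c¬ (¬I A i j c₁ c₂) 1 j

data IsNegE : Tree → Set where
  isNegE : ∀ {C m a} → IsNegE (¬E C m a)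

-- The occurrence at position q of Π is the major premise of an application
-- of ∗E (at position p) and is an assumption discharged, as major
-- assumption, by an application of ∗I (or TR) at position r.
MaximalFormula : Tree → Pos → Set
MaximalFormula Π q =
  Σ Conn λ ∗ →
  (Σ Pos λ p → Σ ℕ λ k → Σ Tree λ t →
     (q ≡ p ++ (k ∷ [])) × (at Π p ≡ just t) × Elim ∗ t k)
  ×
  (Σ Pos λ r → Σ ℕ λ k → Σ Pos λ s → Σ Tree λ u → Σ Tree λ c →
   Σ ℕ λ i → Σ Formula λ F →
     (q ≡ r ++ (k ∷ s)) × (at Π r ≡ just u) × IntroMajor ∗ u k i ×
     (child u k ≡ just c) × OpenAt c s i F)

-- ArbChain t s : following s from the root of t, each step goes from the
-- conclusion of a rule application to one of its arbitrary premises, which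
-- is an occurrence of the same formula.
data ArbChain : Tree → List ℕ → Set where
  []  : ∀ {t} → ArbChain t []
  _∷_ : ∀ {t k c s} → Arbitrary t k × (child t k ≡ just c) × (concl c ≡ concl t) →
        ArbChain c s → ArbChain t (k ∷ s)

NotArbitraryPremise : Tree → Pos → Set
NotArbitraryPremise Π q =
  ∀ p k t → q ≡ p ++ (k ∷ []) → at Π p ≡ just t → ¬ Arbitrary t k

-- Segment Π q s : the segment whose last formula C_n is the occurrence at q
-- and whose first formula C_1 is the occurrence at q ++ s; the formulas
-- C_1,...,C_n are the occurrences at the prefixes of q ++ s of length
-- ≥ length q (so n = length s + 1).
Segment : Tree → Pos → List ℕ → Set
Segment Π q s =
  Σ Tree λ t → (at Π q ≡ just t) × ArbChain t s × NotArbitraryPremise Π q ×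
  ((s ≢ []) ⊎ (Σ Tree λ u → (at t s ≡ just u) × IsNegE u))

MaximalSegment : Tree → Pos → List ℕ → Set
MaximalSegment Π q s =
  Segment Π q s ×
  (Σ Conn λ ∗ → Σ Pos λ p → Σ ℕ λ k → Σ Tree λ t →
     (q ≡ p ++ (k ∷ [])) × (at Π p ≡ just t) × Elim ∗ t k)

NormalForm : Tree → Set
NormalForm Π = (∀ q → ¬ MaximalFormula Π q) × (∀ q s → ¬ MaximalSegment Π q s)

{-# OPTIONS --safe #-}
-- A major premise of an elimination is never an arbitrary premise, so it is the
-- last formula of any segment through it. If it is not an assumption, it is
-- either the conclusion of ¬E (a one-formula segment) or the conclusion of some
-- other rule, all of which have an arbitrary premise that is an occurrence of the
-- same formula (a two-formula segment). Either segment would be maximal.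
module Submission where

open import Defs
open import Data.Nat using (ℕ)
open import Data.List using (List; []; _∷_; _++_; [_])
open import Data.List.Properties using (∷ʳ-injective)
open import Data.Maybe using (just; nothing)
open import Data.Product using (Σ; _,_)
open import Data.Sum using (_⊎_; inj₁; inj₂)
open import Data.Empty using (⊥-elim)
open import Relation.Nullary using (¬_)
open import Relation.Binary.PropositionalEquality using (_≡_; refl; sym; trans)

at-++ : ∀ Π p q {t} → at Π p ≡ just t → at Π (p ++ q) ≡ at t q
at-++ Π []      q refl = refl
at-++ Π (k ∷ p) q eq with child Π k | eq
... | just c  | eq′ = at-++ c p q eq′
... | nothing | ()

at-child : ∀ Π p {t k c} → at Π p ≡ just t → child t k ≡ just c →
           at Π (p ++ [ k ]) ≡ just c
at-child Π p {t} {k} at-p child-k with at-++ Π p [ k ] at-p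
... | eq with child t k | child-k
... | just c | refl = eq

Elim⇒major : ∀ {∗ t k} → Elim ∗ t k → Σ Tree λ m → child t k ≡ just m
Elim⇒major (e∧ {m = m}) = m , refl
Elim⇒major (e∨ {m = m}) = m , refl
Elim⇒major (e⊃ {m = m}) = m , refl
Elim⇒major (e¬ {m = m}) = m , refl

Elim⇒¬Arbitrary : ∀ {∗ t k} → Elim ∗ t k → ¬ Arbitrary t k
Elim⇒¬Arbitrary e∧ ()
Elim⇒¬Arbitrary e∨ ()
Elim⇒¬Arbitrary e⊃ ()
Elim⇒¬Arbitrary e¬ ()

major-notArbitraryPremise : ∀ Π {∗ p t k} → at Π p ≡ just t → Elim ∗ t k →
                            NotArbitraryPremise Π (p ++ [ k ])
major-notArbitraryPremise Π {p = p} at-p el p′ k′ t′ eq at-p′ arb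
  with ∷ʳ-injective p′ p (sym eq)
... | refl , refl with trans (sym at-p) at-p′
... | refl = Elim⇒¬Arbitrary el arb

data EndFormulaOrigin (t : Tree) : Set where
  assumption : ∀ i A → t ≡ hyp i A → EndFormulaOrigin t
  ¬E-conclusion : IsNegE t → EndFormulaOrigin t
  arbitrary-premise : ∀ k c → Arbitrary t k → child t k ≡ just c →
                      concl c ≡ concl t → EndFormulaOrigin t

endFormulaOrigin : ∀ t → EndFormulaOrigin t
endFormulaOrigin (hyp i A)          = assumption i A refl
endFormulaOrigin (∧I i a b c)       = arbitrary-premise 2 c a∧I refl refl
endFormulaOrigin (∧E i j m c)       = arbitrary-premise 1 c a∧E refl refl
endFormulaOrigin (∨I₁ B i a c)      = arbitrary-premise 1 c a∨I₁ refl refl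
endFormulaOrigin (∨I₂ A i b c)      = arbitrary-premise 1 c a∨I₂ refl refl
endFormulaOrigin (∨E i j m c₁ c₂)   = arbitrary-premise 1 c₁ a∨E₁ refl refl
endFormulaOrigin (⊃I A i b c)       = arbitrary-premise 1 c a⊃I refl refl
endFormulaOrigin (TR A B i j c₁ c₂) = arbitrary-premise 0 c₁ aTR₁ refl refl
endFormulaOrigin (⊃E i m a c)       = arbitrary-premise 2 c a⊃E refl refl
endFormulaOrigin (¬I A i j c₁ c₂)   = arbitrary-premise 0 c₁ a¬I₁ refl refl
endFormulaOrigin (¬E C m a)         = ¬E-conclusion isNegE

assumption-or-segmentEnd : ∀ Π q {t} → at Π q ≡ just t → NotArbitraryPremise Π q →
                           (Σ ℕ λ i → Σ Formula λ A → t ≡ hyp i A) ⊎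
                           (Σ (List ℕ) λ s → Segment Π q s)
assumption-or-segmentEnd Π q {t} at-q notArb with endFormulaOrigin t
... | assumption i A t≡hyp = inj₁ (i , A , t≡hyp)
... | ¬E-conclusion negE =
  inj₂ ([] , t , at-q , [] , notArb , inj₂ (t , refl , negE))
... | arbitrary-premise k c arb child-k same =
  inj₂ ([ k ] , t , at-q , (arb , child-k , same) ∷ [] , notArb , inj₁ λ ())

theorem3 : (Π : Tree) → Deduction Π → NormalForm Π →
    ∀ (∗ : Conn) (p : Pos) (t : Tree) (k : ℕ) → at Π p ≡ just t → Elim ∗ t k →
    Σ ℕ λ i → Σ Formula λ A → at Π (p ++ (k ∷ [])) ≡ just (hyp i A)
theorem3 Π _ (_ , noMaximalSegment) ∗ p t k at-p el
  with Elim⇒major el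
... | m , child-k
  with at-child Π p at-p child-k
... | at-major
  with assumption-or-segmentEnd Π (p ++ [ k ]) at-major
         (major-notArbitraryPremise Π at-p el)
... | inj₁ (i , A , refl) = i , A , at-major
... | inj₂ (s , segment) =
  ⊥-elim (noMaximalSegment _ s (segment , ∗ , p , k , t , refl , at-p , el))
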